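{- Let $n\ge1$ and let $x_1,\dots,x_{n+1}$ be the free generators of the free lattice $\mathbf F_{n+1}$. If $c_1,\dots,c_n\in\mathbf F_{n+1}$ satisfy $c_1\wedge\cdots\wedge c_n=0$ and $c_1\vee\cdots\vee c_n=1$ (the least and greatest elements of $\mathbf F_{n+1}$), then for each generator $x_j$ there exist $i,k\in\{1,\dots,n\}$ with $c_i\le x_j\le c_k$.
   Context: $\mathbf F_{n+1}$ is the free lattice on $n+1$ generators; its least element is $x_1\wedge\cdots\wedge x_{n+1}$ and its greatest element is $x_1\vee\cdots\vee x_{n+1}$. -}

module Defs where

open import Data.Nat using (ℕ; suc)
open import Data.Fin using (Fin; zero; suc)
open import Data.Product using (_×_)

data Term (g : ℕ) : Set where
  var  : Fin g → Term g
  _∧ₜ_ : Term g → Term g → Term g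
  _∨ₜ_ : Term g → Term g → Term g

infixr 7 _∧ₜ_
infixr 6 _∨ₜ_
infix 4 _≼_ _≈ₗ_

-- The order of the free lattice F_g: the least preorder on terms making
-- ∧ₜ a greatest lower bound and ∨ₜ a least upper bound (the standard
-- term-algebra construction of the free lattice; F_g = Term g / (≼ ∩ ≽)).
data _≼_ {g : ℕ} : Term g → Term g → Set where
  ≼-refl  : ∀ {p} → p ≼ p
  ≼-trans : ∀ {p q r} → p ≼ q → q ≼ r → p ≼ r
  ∧-lb₁   : ∀ {p q} → p ∧ₜ q ≼ p
  ∧-lb₂   : ∀ {p q} → p ∧ₜ q ≼ q
  ∧-glb   : ∀ {p q r} → r ≼ p → r ≼ q → r ≼ p ∧ₜ q
  ∨-ub₁   : ∀ {p q} → p ≼ p ∨ₜ q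
  ∨-ub₂   : ∀ {p q} → q ≼ p ∨ₜ q
  ∨-lub   : ∀ {p q r} → p ≼ r → q ≼ r → p ∨ₜ q ≼ r

_≈ₗ_ : ∀ {g} → Term g → Term g → Set
p ≈ₗ q = (p ≼ q) × (q ≼ p)

⋀ : ∀ {g m} → (Fin (suc m) → Term g) → Term g
⋀ {m = 0}     a = a zero
⋀ {m = suc m} a = a zero ∧ₜ ⋀ (λ i → a (suc i))

⋁ : ∀ {g m} → (Fin (suc m) → Term g) → Term g
⋁ {m = 0}     a = a zero
⋁ {m = suc m} a = a zero ∨ₜ ⋁ (λ i → a (suc i))

bot : ∀ {m} → Term (suc m)
bot = ⋀ var

top : ∀ {m} → Term (suc m)
top = ⋁ var

{-# OPTIONS --safe #-}
module Submission where

-- Whitman's solution of the word problem: the order of the free lattice is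
-- generated by a cut-free sequent calculus, in which the only rules that can
-- conclude  p ∧ q ⊑ var j  or  var j ⊑ p ∨ q  are the left-∧ and right-∨
-- rules.  Hence every generator is meet- and join-prime.  Now
-- ⋀ c ≼ bot ≼ var j  gives some  c i ≼ var j, and dually  var j ≼ top ≼ ⋁ c
-- gives some  var j ≼ c k.

open import Defs
open import Data.Nat using (ℕ; suc)
open import Data.Fin using (Fin; zero; suc)
open import Data.Product using (_×_; ∃-syntax; _,_; map₂)

infix 4 _⊑_

data _⊑_ {g : ℕ} : Term g → Term g → Set where
  var-refl : ∀ {i} → var i ⊑ var i
  ∧ˡ₁      : ∀ {p q r} → p ⊑ r → p ∧ₜ q ⊑ r
  ∧ˡ₂      : ∀ {p q r} → q ⊑ r → p ∧ₜ q ⊑ r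
  ∨ˡ       : ∀ {p q r} → p ⊑ r → q ⊑ r → p ∨ₜ q ⊑ r
  ∧ʳ       : ∀ {p q r} → r ⊑ p → r ⊑ q → r ⊑ p ∧ₜ q
  ∨ʳ₁      : ∀ {p q r} → r ⊑ p → r ⊑ p ∨ₜ q
  ∨ʳ₂      : ∀ {p q r} → r ⊑ q → r ⊑ p ∨ₜ q

⊑-refl : ∀ {g} (p : Term g) → p ⊑ p
⊑-refl (var i)  = var-refl
⊑-refl (p ∧ₜ q) = ∧ʳ (∧ˡ₁ (⊑-refl p)) (∧ˡ₂ (⊑-refl q))
⊑-refl (p ∨ₜ q) = ∨ˡ (∨ʳ₁ (⊑-refl p)) (∨ʳ₂ (⊑-refl q))

-- Cut elimination: either a side derivation ends in a rule that commutes with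
-- the cut, or both end in matching right/left rules on the cut formula.
⊑-trans : ∀ {g} {p q r : Term g} → p ⊑ q → q ⊑ r → p ⊑ r
⊑-trans (∧ˡ₁ d)    e          = ∧ˡ₁ (⊑-trans d e)
⊑-trans (∧ˡ₂ d)    e          = ∧ˡ₂ (⊑-trans d e)
⊑-trans (∨ˡ d₁ d₂) e          = ∨ˡ (⊑-trans d₁ e) (⊑-trans d₂ e)
⊑-trans d          (∧ʳ e₁ e₂) = ∧ʳ (⊑-trans d e₁) (⊑-trans d e₂)
⊑-trans d          (∨ʳ₁ e)    = ∨ʳ₁ (⊑-trans d e)
⊑-trans d          (∨ʳ₂ e)    = ∨ʳ₂ (⊑-trans d e)
⊑-trans var-refl   var-refl   = var-refl
⊑-trans (∧ʳ d₁ _)  (∧ˡ₁ e)    = ⊑-trans d₁ e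
⊑-trans (∧ʳ _ d₂)  (∧ˡ₂ e)    = ⊑-trans d₂ e
⊑-trans (∨ʳ₁ d)    (∨ˡ e₁ _)  = ⊑-trans d e₁
⊑-trans (∨ʳ₂ d)    (∨ˡ _ e₂)  = ⊑-trans d e₂

≼⇒⊑ : ∀ {g} {p q : Term g} → p ≼ q → p ⊑ q
≼⇒⊑ {p = p}      ≼-refl        = ⊑-refl p
≼⇒⊑              (≼-trans d e) = ⊑-trans (≼⇒⊑ d) (≼⇒⊑ e)
≼⇒⊑ {p = p ∧ₜ _} ∧-lb₁         = ∧ˡ₁ (⊑-refl p)
≼⇒⊑ {p = _ ∧ₜ q} ∧-lb₂         = ∧ˡ₂ (⊑-refl q)
≼⇒⊑              (∧-glb d e)   = ∧ʳ (≼⇒⊑ d) (≼⇒⊑ e)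
≼⇒⊑ {q = p ∨ₜ _} ∨-ub₁         = ∨ʳ₁ (⊑-refl p)
≼⇒⊑ {q = _ ∨ₜ q} ∨-ub₂         = ∨ʳ₂ (⊑-refl q)
≼⇒⊑              (∨-lub d e)   = ∨ˡ (≼⇒⊑ d) (≼⇒⊑ e)

⊑⇒≼ : ∀ {g} {p q : Term g} → p ⊑ q → p ≼ q
⊑⇒≼ var-refl   = ≼-refl
⊑⇒≼ (∧ˡ₁ d)    = ≼-trans ∧-lb₁ (⊑⇒≼ d)
⊑⇒≼ (∧ˡ₂ d)    = ≼-trans ∧-lb₂ (⊑⇒≼ d)
⊑⇒≼ (∨ˡ d e)   = ∨-lub (⊑⇒≼ d) (⊑⇒≼ e)
⊑⇒≼ (∧ʳ d e)   = ∧-glb (⊑⇒≼ d) (⊑⇒≼ e)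
⊑⇒≼ (∨ʳ₁ d)    = ≼-trans (⊑⇒≼ d) ∨-ub₁
⊑⇒≼ (∨ʳ₂ d)    = ≼-trans (⊑⇒≼ d) ∨-ub₂

⋀-lowerBound : ∀ {g m} (a : Fin (suc m) → Term g) (i : Fin (suc m)) → ⋀ a ≼ a i
⋀-lowerBound {m = 0}     a zero    = ≼-refl
⋀-lowerBound {m = suc m} a zero    = ∧-lb₁
⋀-lowerBound {m = suc m} a (suc i) = ≼-trans ∧-lb₂ (⋀-lowerBound (λ k → a (suc k)) i)

⋁-upperBound : ∀ {g m} (a : Fin (suc m) → Term g) (i : Fin (suc m)) → a i ≼ ⋁ a
⋁-upperBound {m = 0}     a zero    = ≼-refl
⋁-upperBound {m = suc m} a zero    = ∨-ub₁
⋁-upperBound {m = suc m} a (suc i) = ≼-trans (⋁-upperBound (λ k → a (suc k)) i) ∨-ub₂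

⋀⊑var⇒∃⊑var : ∀ {g m} (a : Fin (suc m) → Term g) {j : Fin g} →
              ⋀ a ⊑ var j → ∃[ i ] a i ⊑ var j
⋀⊑var⇒∃⊑var {m = 0}     a d        = zero , d
⋀⊑var⇒∃⊑var {m = suc m} a (∧ˡ₁ d) = zero , d
⋀⊑var⇒∃⊑var {m = suc m} a (∧ˡ₂ d) with ⋀⊑var⇒∃⊑var (λ k → a (suc k)) d
... | i , e = suc i , e

var⊑⋁⇒∃var⊑ : ∀ {g m} (a : Fin (suc m) → Term g) {j : Fin g} →
              var j ⊑ ⋁ a → ∃[ i ] var j ⊑ a i
var⊑⋁⇒∃var⊑ {m = 0}     a d        = zero , d
var⊑⋁⇒∃var⊑ {m = suc m} a (∨ʳ₁ d) = zero , d
var⊑⋁⇒∃var⊑ {m = suc m} a (∨ʳ₂ d) with var⊑⋁⇒∃var⊑ (λ k → a (suc k)) d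
... | i , e = suc i , e

var-meetPrime : ∀ {g m} (a : Fin (suc m) → Term g) {j : Fin g} →
                ⋀ a ≼ var j → ∃[ i ] a i ≼ var j
var-meetPrime a d = map₂ ⊑⇒≼ (⋀⊑var⇒∃⊑var a (≼⇒⊑ d))

var-joinPrime : ∀ {g m} (a : Fin (suc m) → Term g) {j : Fin g} →
                var j ≼ ⋁ a → ∃[ i ] var j ≼ a i
var-joinPrime a d = map₂ ⊑⇒≼ (var⊑⋁⇒∃var⊑ a (≼⇒⊑ d))

lemma5p3 : (m : ℕ) (c : Fin (suc m) → Term (suc (suc m))) →
    ⋀ c ≈ₗ bot → ⋁ c ≈ₗ top →
    (j : Fin (suc (suc m))) →
    ∃[ i ] ∃[ k ] ((c i ≼ var j) × (var j ≼ c k))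
lemma5p3 m c (⋀c≼bot , _) (_ , top≼⋁c) j
  with var-meetPrime c (≼-trans ⋀c≼bot (⋀-lowerBound var j))
     | var-joinPrime c (≼-trans (⋁-upperBound var j) top≼⋁c)
... | i , ci≼xj | k , xj≼ck = i , k , ci≼xj , xj≼ck
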